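{- Let $A$ be a set, $I$ a set and $\mathcal{U}$ an ultrafilter over $I$. For any $a,b\in A^I$, $|[a]_{\mathcal{U}}|=|[b]_{\mathcal{U}}|$; that is, all equivalence classes of $A^I/\mathcal{U}$ have the same cardinality.
   Context: $A^I$ is the set of functions $I\to A$, and $[a]_{\mathcal{U}}=\{c\in A^I\mid\{j\in I\mid a(j)=c(j)\}\in\mathcal{U}\}$. -}

module Defs where

open import Level using (0ℓ; suc)
open import Data.Product using (Σ; proj₁; _,_)
open import Data.Sum using (_⊎_)
open import Data.Empty using (⊥)
open import Relation.Nullary using (¬_)
open import Relation.Unary using (Pred; _⊆_; _∩_; ∁; ∅; U) renaming (_∈_ to _∈ₚ_)
open import Relation.Binary.PropositionalEquality using (_≡_; refl; sym; trans)
open import Relation.Binary.Bundles using (Setoid)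

Family : Set → Set₁
Family I = Pred (Pred I 0ℓ) 0ℓ

record IsUltrafilter {I : Set} (𝒰 : Family I) : Set₁ where
  field
    univ     : 𝒰 U
    proper   : ¬ 𝒰 ∅
    up-closed : ∀ {X Y : Pred I 0ℓ} → X ⊆ Y → 𝒰 X → 𝒰 Y
    ∩-closed : ∀ {X Y : Pred I 0ℓ} → 𝒰 X → 𝒰 Y → 𝒰 (X ∩ Y)
    ultra    : ∀ (X : Pred I 0ℓ) → 𝒰 X ⊎ 𝒰 (∁ X)

[_]/ : {A I : Set} → (I → A) → Family I → Setoid 0ℓ 0ℓ
[_]/ {A} {I} a 𝒰 = record
  { Carrier = Σ (I → A) (λ c → 𝒰 (λ j → a j ≡ c j))
  ; _≈_ = λ x y → ∀ j → proj₁ x j ≡ proj₁ y j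
  ; isEquivalence = record
    { refl = λ j → refl
    ; sym = λ p j → sym (p j)
    ; trans = λ p q j → trans (p j) (q j)
    }
  }

{-# OPTIONS --safe #-}

-- Fix for every coordinate j the transposition of A exchanging a j and b j
-- (excluded middle makes equality on A decidable, so it can be defined).
-- Applied coordinatewise it is an involution of A^I carrying
-- {j | a j = c j} into {j | b j = c' j} for the image c' of c, so by upward
-- closure of 𝒰 it maps [a] onto [b], with itself in the other direction.
module Submission where

open import Defs
open import Level using (0ℓ)
open import Axiom.ExcludedMiddle using (ExcludedMiddle)
open import Function.Bundles using (Inverse; _↔_; mk↔ₛ′)
open import Data.Product using (_,_; proj₁)
open import Relation.Nullary using (Dec; yes; no; ¬_; contradiction)
open import Relation.Binary.Bundles using (Setoid)
open import Relation.Binary.Definitions using (DecidableEquality)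
open import Relation.Unary using (Pred; _⊆_)
open import Relation.Binary.PropositionalEquality

module Transposition {A : Set} (_≟_ : DecidableEquality A) (a b : A) where

  transpose : A → A
  transpose x with x ≟ a
  ... | yes _ = b
  ... | no _ with x ≟ b
  ...   | yes _ = a
  ...   | no _  = x

  transpose-a : transpose a ≡ b
  transpose-a with a ≟ a
  ... | yes _   = refl
  ... | no a≢a = contradiction refl a≢a

  transpose-b : transpose b ≡ a
  transpose-b with b ≟ a
  ... | yes b≡a = b≡a
  ... | no _ with b ≟ b
  ...   | yes _   = refl
  ...   | no b≢b = contradiction refl b≢b

  transpose-fixes : ∀ {x} → ¬ x ≡ a → ¬ x ≡ b → transpose x ≡ x
  transpose-fixes {x} x≢a x≢b with x ≟ a
  ... | yes x≡a = contradiction x≡a x≢a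
  ... | no _ with x ≟ b
  ...   | yes x≡b = contradiction x≡b x≢b
  ...   | no _    = refl

  transpose-involutive : ∀ x → transpose (transpose x) ≡ x
  transpose-involutive x = by-cases (x ≟ a) (x ≟ b)
    where
    -- A with on x ≟ a would also rewrite inside the outer transpose call,
    -- leaving goals that transpose-a and transpose-b no longer match.
    by-cases : ∀ {y} → Dec (y ≡ a) → Dec (y ≡ b) → transpose (transpose y) ≡ y
    by-cases (yes refl) _          = trans (cong transpose transpose-a) transpose-b
    by-cases (no _)     (yes refl) = trans (cong transpose transpose-b) transpose-a
    by-cases (no y≢a)   (no y≢b)   = trans (cong transpose fixed) fixed
      where fixed = transpose-fixes y≢a y≢b

  transpose-↔ : A ↔ A
  transpose-↔ = mk↔ₛ′ transpose transpose transpose-involutive transpose-involutive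

UpwardClosed : {I : Set} → Family I → Set₁
UpwardClosed {I} 𝒰 = ∀ {X Y : Pred I 0ℓ} → X ⊆ Y → 𝒰 X → 𝒰 Y

module _ {A I : Set} {𝒰 : Family I} (up-closed : UpwardClosed 𝒰) where

  map-class : {a b : I → A} (f : I → A → A) → (∀ j → f j (a j) ≡ b j) →
              Setoid.Carrier ([ a ]/ 𝒰) → Setoid.Carrier ([ b ]/ 𝒰)
  map-class f fa≡b (c , a≈c) =
    (λ j → f j (c j)) , up-closed (λ {j} a≡c → trans (sym (fa≡b j)) (cong (f j) a≡c)) a≈c

  pointwise↔⇒class↔ : {a b : I → A} (σ : I → A ↔ A) → (∀ j → Inverse.to (σ j) (a j) ≡ b j) →
                       Inverse ([ a ]/ 𝒰) ([ b ]/ 𝒰)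
  pointwise↔⇒class↔ {a} {b} σ σa≡b = record
    { to        = map-class (λ j → to (σ j)) σa≡b
    ; from      = map-class (λ j → from (σ j)) σ⁻¹b≡a
    ; to-cong   = λ c≈d j → cong (to (σ j)) (c≈d j)
    ; from-cong = λ c≈d j → cong (from (σ j)) (c≈d j)
    ; inverse   = (λ {c} d≈c j → trans (cong (to (σ j)) (d≈c j))
                                         (strictlyInverseˡ (σ j) (proj₁ c j)))
                , (λ {c} d≈c j → trans (cong (from (σ j)) (d≈c j))
                                         (strictlyInverseʳ (σ j) (proj₁ c j)))
    }
    where
    open Inverse
    σ⁻¹b≡a : ∀ j → from (σ j) (b j) ≡ a j
    σ⁻¹b≡a j = trans (cong (from (σ j)) (sym (σa≡b j))) (strictlyInverseʳ (σ j) (a j))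

proposition5p19 : ExcludedMiddle 0ℓ → {A I : Set} → (𝒰 : Family I) → IsUltrafilter 𝒰 →
    (a b : I → A) → Inverse ([ a ]/ 𝒰) ([ b ]/ 𝒰)
proposition5p19 em 𝒰 uf a b =
  pointwise↔⇒class↔ (IsUltrafilter.up-closed uf)
    (λ j → transpose-↔ (a j) (b j)) (λ j → transpose-a (a j) (b j))
  where open Transposition (λ _ _ → em)
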